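{- Let $\mathcal{C}$ be a pattern-avoiding class of permutations. Solving the Longest Common $\mathcal{C}$-Pattern problem does not approximate the Longest Common Pattern problem within a ratio tighter than $\sqrt{Opt}$, where $Opt$ is the length of an optimal solution of the Longest Common Pattern problem: namely, for every $\epsilon>0$ there are instances $X=\{\sigma_n,\sigma_n\}$ with $\sigma_n$ of length $n$ (so $Opt = n$) for which the longest common pattern belonging to $\mathcal{C}$ has length $o(n^{0.5+\epsilon})$.
   Context: A permutation of length $n$ is a bijection of $[1..n]$, written $\sigma_1\cdots\sigma_n$. A permutation $\pi$ of length $k$ is a pattern of $\sigma$ of length $n$ if there are indices $1 \le i_1<\cdots<i_k \le n$ with $\sigma_{i_\ell} < \sigma_{i_m}$ whenever $\pi_\ell < \pi_m$; otherwise $\sigma$ avoids $\pi$. A pattern-avoiding class is a class $S(\tau_1,\ldots,\tau_m)$ ($m\ge1$) of all permutations avoiding each $\tau_i$. The Longest Common Pattern problem: given a set $X$ of permutations, find a permutation of maximal length that is a pattern of every $\sigma \in X$. The Longest Common $\mathcal{C}$-Pattern problem: given $X$, find a permutation in $\mathcal{C}$ of maximal length that is a pattern of every $\sigma \in X$.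
   Formalization: The parameter ε ranges over the positive rationals, and the constant implicit in the bound $o(n^{0.5+\epsilon})$ is likewise taken to be a positive rational. -}

module Defs where

open import Data.Nat using (ℕ; suc; _+_; _*_; _^_; _≤_; _≥_)
open import Data.Fin using (Fin) renaming (_<_ to _<ᶠ_)
open import Data.Fin.Permutation using (Permutation′; _⟨$⟩ʳ_)
open import Data.List using (List; _∷_; [])
open import Data.List.NonEmpty using (List⁺; toList)
open import Data.List.Relation.Unary.All using (All)
open import Data.Product using (Σ; ∃; _×_; _,_)
open import Relation.Nullary using (¬_)

Perm : ℕ → Set
Perm = Permutation′

AnyPerm : Set
AnyPerm = Σ ℕ Perm

IsPattern : ∀ {k n} → Perm k → Perm n → Set
IsPattern {k} {n} π σ =
  Σ (Fin k → Fin n) λ i →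
    (∀ l m → l <ᶠ m → i l <ᶠ i m) ×
    (∀ l m → (π ⟨$⟩ʳ l) <ᶠ (π ⟨$⟩ʳ m) → (σ ⟨$⟩ʳ i l) <ᶠ (σ ⟨$⟩ʳ i m))

-- A pattern-avoiding class S(τ_1,...,τ_m), m ≥ 1, is given by the
-- nonempty list of its basis patterns.
PatternClass : Set
PatternClass = List⁺ AnyPerm

_∈S_ : ∀ {k} → Perm k → PatternClass → Set
π ∈S C = All (λ τ → ¬ IsPattern (Data.Product.proj₂ τ) π) (toList C)

IsCommonPattern : ∀ {k} → Perm k → List AnyPerm → Set
IsCommonPattern π X = All (λ σ → IsPattern π (Data.Product.proj₂ σ)) X

IsCommonCPattern : PatternClass → ∀ {k} → Perm k → List AnyPerm → Set
IsCommonCPattern C π X = (π ∈S C) × IsCommonPattern π X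

-- "f(n) = o(n^(1/2 + p/q))" for the length-valued quantity given by a
-- property "every admissible length ℓ at n": for every rational δ = a/b > 0
-- there is N such that for all n ≥ N every admissible ℓ satisfies
-- ℓ ≤ (a/b) n^(1/2+p/q), i.e. (b ℓ)^(2q) ≤ a^(2q) n^(q + 2p).
LittleOPow : (Adm : ℕ → ℕ → Set) → (p q : ℕ) → Set
LittleOPow Adm p q =
  ∀ a b → ∃ λ N → ∀ n → n ≥ N → ∀ ℓ → Adm n ℓ →
    ((suc b) * ℓ) ^ (2 * q) ≤ (suc a) ^ (2 * q) * n ^ (q + 2 * p)

{-# OPTIONS --safe #-}
module Submission where

-- The n-th witness transposes the m × m grid formed by its first m² positions, m = ⌊√n⌋
-- (q * m + r ↦ r * m + q), and fixes the remaining n − m² ≤ 2m positions. Cutting positions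
-- and values into the m grid blocks and one block per fixed point is a gridding with
-- M ≤ 3m blocks each way and at most one point per cell. A pattern π of it that avoids a
-- basis element τ of the class therefore yields a τ-avoiding 0-1 matrix of size M with
-- |π| ones, and by the Marcus–Tardos theorem |π| ≤ c M = O(√n), which is o(n^(1/2+ε)).
--
-- The Marcus–Tardos bound comes from cutting a τ-avoiding matrix of size K m into K × K
-- blocks. Call a block wide (tall) if at least k = |τ| of its columns (rows) are nonempty.
-- k blocks of one block column whose nonempty columns include the same k columns contain τ,
-- so by pigeonhole each block column has at most K^k (k − 1) wide blocks, and likewise for
-- tall blocks. Every other block has at most (k − 1)² ones, and the nonempty blocks form a
-- τ-avoiding matrix of size m: weight (K m) ≤ 2 K² K^k (k − 1) m + (k − 1)² weight m.

open import Defs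
open import Data.Nat using (ℕ; suc)
open import Data.List using (_∷_; [])
open import Data.Product using (Σ; _,_)

open import Data.Bool using (Bool; true; false; T)
open import Data.Bool.Properties using (T?)
open import Data.Empty using (⊥-elim)
open import Data.Fin using (Fin; zero; suc; toℕ; fromℕ<) renaming (_<_ to _<ᶠ_)
open import Data.Fin.Permutation as Permutation
  using (_⟨$⟩ʳ_; _⟨$⟩ˡ_; flip; inverseˡ; permutation)
open import Data.Fin.Properties
  using (toℕ-injective; toℕ-fromℕ<; toℕ<n; injective⇒≤; all?; any?)
  renaming (_<?_ to _<ᶠ?_; <-cmp to <ᶠ-cmp; <-irrefl to <ᶠ-irrefl; <-asym to <ᶠ-asym)
open import Data.List.NonEmpty using () renaming (_∷_ to _∷⁺_)
open import Data.List.Relation.Unary.All using () renaming (_∷_ to _∷ᴬ_)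
open import Data.Nat
open import Data.Nat.DivMod
open import Data.Nat.Divisibility using (divides-refl)
open import Data.Nat.Properties
open import Data.Nat.Tactic.RingSolver using (solve-∀)
open import Data.Product using (_×_; proj₁; proj₂)
open import Data.Sum using (inj₁; inj₂)
open import Data.Vec as Vec using (Vec; []; lookup)
import Data.Vec.Functional as Vector
open import Data.Vec.Properties using (lookup∘tabulate)
open import Function using (_∘_; id)
open import Relation.Binary using (tri<; tri≈; tri>)
open import Relation.Binary.PropositionalEquality
open import Relation.Nullary using (¬_; Dec; yes; no)
open import Relation.Nullary.Decidable using (⌊_⌋; toWitness; fromWitness; _×-dec_; _→-dec_)

open import Algebra.Properties.Semiring.Sum +-*-semiring
  using (sum; ∑-comm; ∑-distrib-+; *-distribˡ-sum)

-- Finite sums and counting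

-- Via the library's sums over Fin n; ∑< (suc n) f still unfolds to f 0 + ∑< n (f ∘ suc).
∑< : ℕ → (ℕ → ℕ) → ℕ
∑< n f = sum {n} (f ∘ toℕ)

syntax ∑< n (λ x → e) = ∑[ x < n ] e

∑<-cong : ∀ n {f g : ℕ → ℕ} → (∀ x → x < n → f x ≡ g x) → ∑< n f ≡ ∑< n g
∑<-cong zero    f≗g = refl
∑<-cong (suc n) f≗g = cong₂ _+_ (f≗g 0 z<s) (∑<-cong n (λ x x<n → f≗g (suc x) (s<s x<n)))

∑<-mono-≤ : ∀ n {f g : ℕ → ℕ} → (∀ x → x < n → f x ≤ g x) → ∑< n f ≤ ∑< n g
∑<-mono-≤ zero    f≤g = z≤n
∑<-mono-≤ (suc n) f≤g = +-mono-≤ (f≤g 0 z<s) (∑<-mono-≤ n (λ x x<n → f≤g (suc x) (s<s x<n)))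

∑<-distrib-+ : ∀ n (f g : ℕ → ℕ) → ∑[ x < n ] (f x + g x) ≡ ∑< n f + ∑< n g
∑<-distrib-+ n f g = ∑-distrib-+ {n} (f ∘ toℕ) (g ∘ toℕ)

∑<-comm : ∀ m n (f : ℕ → ℕ → ℕ) → ∑[ x < m ] ∑[ y < n ] f x y ≡ ∑[ y < n ] ∑[ x < m ] f x y
∑<-comm m n f = ∑-comm {m} {n} (λ i j → f (toℕ i) (toℕ j))

*-distribˡ-∑< : ∀ n c (f : ℕ → ℕ) → c * ∑< n f ≡ ∑[ x < n ] (c * f x)
*-distribˡ-∑< n c f = *-distribˡ-sum {n} c (f ∘ toℕ)

∑<-const : ∀ n c → ∑[ _ < n ] c ≡ n * c
∑<-const zero    c = refl
∑<-const (suc n) c = cong (c +_) (∑<-const n c)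

∑<-++ : ∀ m n (f : ℕ → ℕ) → ∑< (m + n) f ≡ ∑< m f + ∑[ x < n ] f (m + x)
∑<-++ zero    n f = refl
∑<-++ (suc m) n f = trans (cong (f 0 +_) (∑<-++ m n (f ∘ suc))) (sym (+-assoc (f 0) _ _))

∑<-blocks : ∀ m d (f : ℕ → ℕ) → ∑< (m * d) f ≡ ∑[ q < m ] ∑[ r < d ] f (q * d + r)
∑<-blocks zero    d f = refl
∑<-blocks (suc m) d f = begin
  ∑< (d + m * d) f
    ≡⟨ ∑<-++ d (m * d) f ⟩
  ∑< d f + ∑[ x < m * d ] f (d + x)
    ≡⟨ cong (∑< d f +_) (∑<-blocks m d (λ x → f (d + x))) ⟩
  ∑< d f + ∑[ q < m ] ∑[ r < d ] f (d + (q * d + r))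
    ≡⟨ cong (∑< d f +_) (∑<-cong m λ q _ → ∑<-cong d λ r _ → cong f (sym (+-assoc d (q * d) r))) ⟩
  ∑< d f + ∑[ q < m ] ∑[ r < d ] f (suc q * d + r) ∎
  where open ≡-Reasoning

∑<-monoˡ-≤ : ∀ {m n} (f : ℕ → ℕ) → m ≤ n → ∑< m f ≤ ∑< n f
∑<-monoˡ-≤ {m} {n} f m≤n = begin
  ∑< m f                                ≤⟨ m≤m+n _ _ ⟩
  ∑< m f + ∑[ x < n ∸ m ] f (m + x)     ≡⟨ sym (∑<-++ m (n ∸ m) f) ⟩
  ∑< (m + (n ∸ m)) f                    ≡⟨ cong (λ l → ∑< l f) (m+[n∸m]≡n m≤n) ⟩
  ∑< n f                                ∎
  where open ≤-Reasoning

∑<-term : ∀ n (f : ℕ → ℕ) {x} → x < n → f x ≤ ∑< n f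
∑<-term (suc n) f {zero}  _         = m≤m+n (f 0) _
∑<-term (suc n) f {suc x} (s<s x<n) = ≤-trans (∑<-term n (f ∘ suc) x<n) (m≤n+m _ (f 0))

∑<-*-∑< : ∀ m n (f g : ℕ → ℕ) → ∑[ x < m ] ∑[ y < n ] (f x * g y) ≡ ∑< m f * ∑< n g
∑<-*-∑< m n f g = begin
  ∑[ x < m ] ∑[ y < n ] (f x * g y)   ≡⟨ ∑<-cong m (λ x _ → sym (*-distribˡ-∑< n (f x) g)) ⟩
  ∑[ x < m ] (f x * ∑< n g)           ≡⟨ ∑<-cong m (λ x _ → *-comm (f x) (∑< n g)) ⟩
  ∑[ x < m ] (∑< n g * f x)           ≡⟨ sym (*-distribˡ-∑< m (∑< n g) f) ⟩
  ∑< n g * ∑< m f                     ≡⟨ *-comm (∑< n g) (∑< m f) ⟩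
  ∑< m f * ∑< n g                     ∎
  where open ≡-Reasoning

∑<-linear₃ : ∀ n a b c (f g h : ℕ → ℕ) →
  ∑[ x < n ] (a * f x + b * g x + c * h x) ≡ a * ∑< n f + b * ∑< n g + c * ∑< n h
∑<-linear₃ n a b c f g h = begin
  ∑[ x < n ] (a * f x + b * g x + c * h x)
    ≡⟨ ∑<-distrib-+ n (λ x → a * f x + b * g x) (λ x → c * h x) ⟩
  ∑[ x < n ] (a * f x + b * g x) + ∑[ x < n ] (c * h x)
    ≡⟨ cong (_+ ∑[ x < n ] (c * h x)) (∑<-distrib-+ n (λ x → a * f x) (λ x → b * g x)) ⟩
  ∑[ x < n ] (a * f x) + ∑[ x < n ] (b * g x) + ∑[ x < n ] (c * h x)
    ≡⟨ sym (cong₂ _+_ (cong₂ _+_ (*-distribˡ-∑< n a f) (*-distribˡ-∑< n b g)) (*-distribˡ-∑< n c h)) ⟩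
  a * ∑< n f + b * ∑< n g + c * ∑< n h ∎
  where open ≡-Reasoning

Increasing : ∀ {k} → (Fin k → ℕ) → Set
Increasing f = ∀ a b → a <ᶠ b → f a < f b

𝟙 : Bool → ℕ
𝟙 true  = 1
𝟙 false = 0

T⇒𝟙≡1 : ∀ {b} → T b → 𝟙 b ≡ 1
T⇒𝟙≡1 {true} _ = refl

𝟙≤1 : ∀ b → 𝟙 b ≤ 1
𝟙≤1 true  = ≤-refl
𝟙≤1 false = z≤n

count : ℕ → (ℕ → Bool) → ℕ
count n p = ∑[ x < n ] 𝟙 (p x)

count≤ : ∀ n p → count n p ≤ n
count≤ n p = begin
  count n p       ≤⟨ ∑<-mono-≤ n (λ x _ → 𝟙≤1 (p x)) ⟩
  ∑[ _ < n ] 1    ≡⟨ ∑<-const n 1 ⟩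
  n * 1           ≡⟨ *-identityʳ n ⟩
  n               ∎
  where open ≤-Reasoning

count-suc : ∀ n p → count (suc n) p ≡ count n p + 𝟙 (p n)
count-suc n p = begin
  count (suc n) p                   ≡⟨ cong (λ l → count l p) (+-comm 1 n) ⟩
  count (n + 1) p                   ≡⟨ ∑<-++ n 1 (𝟙 ∘ p) ⟩
  count n p + (𝟙 (p (n + 0)) + 0)   ≡⟨ cong (count n p +_) (+-identityʳ _) ⟩
  count n p + 𝟙 (p (n + 0))         ≡⟨ cong (λ x → count n p + 𝟙 (p x)) (+-identityʳ n) ⟩
  count n p + 𝟙 (p n)               ∎
  where open ≡-Reasoning

count-< : ∀ {x y} p → x < y → T (p x) → count x p < count y p
count-< {x} {y} p x<y px = begin-strict
  count x p              <⟨ n<1+n _ ⟩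
  suc (count x p)        ≡⟨ +-comm 1 _ ⟩
  count x p + 1          ≡⟨ cong (count x p +_) (sym (T⇒𝟙≡1 px)) ⟩
  count x p + 𝟙 (p x)    ≡⟨ sym (count-suc x p) ⟩
  count (suc x) p        ≤⟨ ∑<-monoˡ-≤ (𝟙 ∘ p) x<y ⟩
  count y p              ∎
  where open ≤-Reasoning

injective⇒≤count : ∀ {ℓ} N p (g : Fin ℓ → ℕ) → (∀ l l' → g l ≡ g l' → l ≡ l') →
  (∀ l → g l < N × T (p (g l))) → ℓ ≤ count N p
injective⇒≤count {ℓ} N p g g-inj g-in = injective⇒≤ {f = rank} rank-injective
  where
    rank : Fin ℓ → Fin (count N p)
    rank l = fromℕ< (count-< p (proj₁ (g-in l)) (proj₂ (g-in l)))

    rank-toℕ : ∀ {l l'} → rank l ≡ rank l' → count (g l) p ≡ count (g l') p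
    rank-toℕ {l} {l'} eq = trans (sym (toℕ-fromℕ< _)) (trans (cong toℕ eq) (toℕ-fromℕ< _))

    rank-injective : ∀ {l l'} → rank l ≡ rank l' → l ≡ l'
    rank-injective {l} {l'} eq with <-cmp (g l) (g l')
    ... | tri≈ _ g≡ _ = g-inj l l' g≡
    ... | tri< g< _ _ = ⊥-elim (<-irrefl (rank-toℕ eq) (count-< p g< (proj₂ (g-in l))))
    ... | tri> _ _ g> = ⊥-elim (<-irrefl (sym (rank-toℕ eq)) (count-< p g> (proj₂ (g-in l'))))

≤count⇒increasing : ∀ k m p → k ≤ count m p →
  Σ (Fin k → ℕ) λ f → Increasing f × (∀ a → f a < m × T (p (f a)))
≤count⇒increasing zero    m       p _ = (λ ()) , (λ ()) , (λ ())
≤count⇒increasing (suc k) zero    p ()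
≤count⇒increasing (suc k) (suc m) p k≤ with p 0 in p0
... | true  =
  let f , f-inc , f-in = ≤count⇒increasing k m (p ∘ suc) (≤-pred k≤)
  in 0 Vector.∷ (suc ∘ f) , cons-increasing f f-inc , λ where
       zero    → z<s , subst T (sym p0) _
       (suc a) → s<s (proj₁ (f-in a)) , proj₂ (f-in a)
  where
    cons-increasing : ∀ {k} (f : Fin k → ℕ) → Increasing f → Increasing (0 Vector.∷ (suc ∘ f))
    cons-increasing f f-inc zero    (suc b) _         = z<s
    cons-increasing f f-inc (suc a) (suc b) (s<s a<b) = s<s (f-inc a b a<b)
... | false =
  let f , f-inc , f-in = ≤count⇒increasing (suc k) m (p ∘ suc) k≤
  in suc ∘ f , (λ a b a<b → s<s (f-inc a b a<b)) , λ a → s<s (proj₁ (f-in a)) , proj₂ (f-in a)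

∑-tuples : (K k : ℕ) → (Vec ℕ k → ℕ) → ℕ
∑-tuples K zero    g = g []
∑-tuples K (suc k) g = ∑[ x < K ] ∑-tuples K k (λ v → g (x Vec.∷ v))

∑-tuples-term : ∀ K k g (v : Vec ℕ k) → (∀ a → lookup v a < K) → g v ≤ ∑-tuples K k g
∑-tuples-term K zero    g []          v<K = ≤-refl
∑-tuples-term K (suc k) g (x Vec.∷ v) v<K =
  ≤-trans (∑-tuples-term K k (λ w → g (x Vec.∷ w)) v (v<K ∘ suc))
          (∑<-term K (λ y → ∑-tuples K k (λ w → g (y Vec.∷ w))) (v<K zero))

∑-tuples-mono-≤ : ∀ K k {g h : Vec ℕ k → ℕ} → (∀ v → g v ≤ h v) →
  ∑-tuples K k g ≤ ∑-tuples K k h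
∑-tuples-mono-≤ K zero    g≤h = g≤h []
∑-tuples-mono-≤ K (suc k) g≤h = ∑<-mono-≤ K (λ x _ → ∑-tuples-mono-≤ K k (λ v → g≤h (x Vec.∷ v)))

∑-tuples-const : ∀ K k c → ∑-tuples K k (λ _ → c) ≡ K ^ k * c
∑-tuples-const K zero    c = sym (+-identityʳ c)
∑-tuples-const K (suc k) c = begin
  ∑[ _ < K ] ∑-tuples K k (λ _ → c)   ≡⟨ ∑<-cong K (λ _ _ → ∑-tuples-const K k c) ⟩
  ∑[ _ < K ] (K ^ k * c)              ≡⟨ ∑<-const K (K ^ k * c) ⟩
  K * (K ^ k * c)                     ≡⟨ sym (*-assoc K (K ^ k) c) ⟩
  K ^ suc k * c                       ∎
  where open ≡-Reasoning

∑<-∑-tuples-comm : ∀ K k m (h : ℕ → Vec ℕ k → ℕ) →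
  ∑[ x < m ] ∑-tuples K k (h x) ≡ ∑-tuples K k (λ v → ∑[ x < m ] h x v)
∑<-∑-tuples-comm K zero    m h = refl
∑<-∑-tuples-comm K (suc k) m h = begin
  ∑[ x < m ] ∑[ y < K ] ∑-tuples K k (λ v → h x (y Vec.∷ v))
    ≡⟨ ∑<-comm m K (λ x y → ∑-tuples K k (λ v → h x (y Vec.∷ v))) ⟩
  ∑[ y < K ] ∑[ x < m ] ∑-tuples K k (λ v → h x (y Vec.∷ v))
    ≡⟨ ∑<-cong K (λ y _ → ∑<-∑-tuples-comm K k m (λ x v → h x (y Vec.∷ v))) ⟩
  ∑[ y < K ] ∑-tuples K k (λ v → ∑[ x < m ] h x (y Vec.∷ v)) ∎
  where open ≡-Reasoning

pigeonhole-count : ∀ K k m c (w : ℕ → Bool) (P : Vec ℕ k → ℕ → Bool) →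
  (∀ x → x < m → T (w x) → Σ (Vec ℕ k) λ v → (∀ a → lookup v a < K) × T (P v x)) →
  (∀ v → count m (P v) ≤ c) → count m w ≤ K ^ k * c
pigeonhole-count K k m c w P witness P-sparse = begin
  count m w                                   ≤⟨ ∑<-mono-≤ m w≤∑P ⟩
  ∑[ x < m ] ∑-tuples K k (λ v → 𝟙 (P v x))   ≡⟨ ∑<-∑-tuples-comm K k m (λ x v → 𝟙 (P v x)) ⟩
  ∑-tuples K k (λ v → count m (P v))          ≤⟨ ∑-tuples-mono-≤ K k P-sparse ⟩
  ∑-tuples K k (λ _ → c)                      ≡⟨ ∑-tuples-const K k c ⟩
  K ^ k * c                                   ∎
  where
    open ≤-Reasoning
    w≤∑P : ∀ x → x < m → 𝟙 (w x) ≤ ∑-tuples K k (λ v → 𝟙 (P v x))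
    w≤∑P x x<m with w x in wx
    ... | false = z≤n
    ... | true = let v , v<K , Pvx = witness x x<m (subst T (sym wx) _) in
      subst (_≤ _) (T⇒𝟙≡1 Pvx) (∑-tuples-term K k (λ v → 𝟙 (P v x)) v v<K)

-- 0-1 matrices and the Marcus–Tardos theorem

Matrix : Set
Matrix = ℕ → ℕ → Bool

_ᵀ : Matrix → Matrix
(A ᵀ) r c = A c r

weight : Matrix → ℕ → ℕ
weight A M = ∑[ r < M ] count M (A r)

Contains : ∀ {k} → Perm k → Matrix → Set
Contains {k} τ A = Σ (Fin k → ℕ) λ r → Σ (Fin k → ℕ) λ c →
  Increasing r × (∀ a b → (τ ⟨$⟩ʳ a) <ᶠ (τ ⟨$⟩ʳ b) → c a < c b) × (∀ a → T (A (r a) (c a)))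

Contains-ᵀ : ∀ {k} (τ : Perm k) A → Contains (flip τ) (A ᵀ) → Contains τ A
Contains-ᵀ τ A (r , c , r-inc , c-ord , ones) =
  c ∘ (τ ⟨$⟩ʳ_) , r ∘ (τ ⟨$⟩ʳ_) , rows-inc , (λ a b → r-inc (τ ⟨$⟩ʳ a) (τ ⟨$⟩ʳ b)) , ones ∘ (τ ⟨$⟩ʳ_)
  where
    rows-inc : Increasing (c ∘ (τ ⟨$⟩ʳ_))
    rows-inc a b a<b = c-ord _ _ (subst₂ _<ᶠ_ (sym (inverseˡ τ)) (sym (inverseˡ τ)) a<b)

increasing? : ∀ {k} (f : Fin k → ℕ) → Dec (Increasing f)
increasing? f = all? λ a → all? λ b → (a <ᶠ? b) →-dec (f a <? f b)

block-< : ∀ {K x y} i j → x < y → i < K → x * K + i < y * K + j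
block-< {K} {x} {y} i j x<y i<K = begin-strict
  x * K + i   <⟨ +-monoʳ-< (x * K) i<K ⟩
  x * K + K   ≡⟨ +-comm (x * K) K ⟩
  suc x * K   ≤⟨ *-monoˡ-≤ K x<y ⟩
  y * K       ≤⟨ m≤m+n (y * K) j ⟩
  y * K + j   ∎
  where open ≤-Reasoning

module Blocks (k' K : ℕ) where

  RowUsed : Matrix → ℕ → ℕ → ℕ → Set
  RowUsed A R C i = Σ ℕ λ j → j < K × T (A (R * K + i) (C * K + j))

  rowUsed? : ∀ A R C i → Dec (RowUsed A R C i)
  rowUsed? A R C i = anyUpTo? (λ j → T? (A (R * K + i) (C * K + j))) K

  ColUsed : Matrix → ℕ → ℕ → ℕ → Set
  ColUsed A R C = RowUsed (A ᵀ) C R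

  colUsed? : ∀ A R C j → Dec (ColUsed A R C j)
  colUsed? A R C = rowUsed? (A ᵀ) C R

  rowsUsed colsUsed : Matrix → ℕ → ℕ → ℕ
  rowsUsed A R C = count K (λ i → ⌊ rowUsed? A R C i ⌋)
  colsUsed A R C = rowsUsed (A ᵀ) C R

  wide tall : Matrix → ℕ → ℕ → Bool
  wide A R C = ⌊ suc k' ≤? colsUsed A R C ⌋
  tall A R C = ⌊ suc k' ≤? rowsUsed A R C ⌋

  contract : Matrix → Matrix
  contract A R C = ⌊ 1 ≤? rowsUsed A R C ⌋

  blockWeight : Matrix → ℕ → ℕ → ℕ
  blockWeight A R C = ∑[ i < K ] count K (λ j → A (R * K + i) (C * K + j))

  weight-blocks : ∀ A m → weight A (m * K) ≡ ∑[ R < m ] ∑[ C < m ] blockWeight A R C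
  weight-blocks A m = begin
    ∑[ r < m * K ] count (m * K) (A r)
      ≡⟨ ∑<-blocks m K (λ r → count (m * K) (A r)) ⟩
    ∑[ R < m ] ∑[ i < K ] count (m * K) (A (R * K + i))
      ≡⟨ ∑<-cong m (λ R _ → ∑<-cong K λ i _ → ∑<-blocks m K (λ c → 𝟙 (A (R * K + i) c))) ⟩
    ∑[ R < m ] ∑[ i < K ] ∑[ C < m ] count K (λ j → A (R * K + i) (C * K + j))
      ≡⟨ ∑<-cong m (λ R _ → ∑<-comm K m (λ i C → count K (λ j → A (R * K + i) (C * K + j)))) ⟩
    ∑[ R < m ] ∑[ C < m ] blockWeight A R C ∎
    where open ≡-Reasoning

  blockWeight≤K*K : ∀ A R C → blockWeight A R C ≤ K * K
  blockWeight≤K*K A R C = begin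
    blockWeight A R C   ≤⟨ ∑<-mono-≤ K (λ i _ → count≤ K (λ j → A (R * K + i) (C * K + j))) ⟩
    ∑[ _ < K ] K        ≡⟨ ∑<-const K K ⟩
    K * K               ∎
    where open ≤-Reasoning

  blockWeight≤rowsUsed*colsUsed : ∀ A R C → blockWeight A R C ≤ rowsUsed A R C * colsUsed A R C
  blockWeight≤rowsUsed*colsUsed A R C = begin
    blockWeight A R C
      ≤⟨ ∑<-mono-≤ K (λ i i<K → ∑<-mono-≤ K (λ j j<K → 𝟙-≤-* (row-used j<K) (col-used i<K))) ⟩
    ∑[ i < K ] ∑[ j < K ] (𝟙 ⌊ rowUsed? A R C i ⌋ * 𝟙 ⌊ colUsed? A R C j ⌋)
      ≡⟨ ∑<-*-∑< K K (λ i → 𝟙 ⌊ rowUsed? A R C i ⌋) (λ j → 𝟙 ⌊ colUsed? A R C j ⌋) ⟩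
    rowsUsed A R C * colsUsed A R C ∎
    where
      open ≤-Reasoning
      row-used : ∀ {i j} → j < K → T (A (R * K + i) (C * K + j)) → T ⌊ rowUsed? A R C i ⌋
      row-used {j = j} j<K one = fromWitness (j , j<K , one)
      col-used : ∀ {i j} → i < K → T (A (R * K + i) (C * K + j)) → T ⌊ colUsed? A R C j ⌋
      col-used {i = i} i<K one = fromWitness (i , i<K , one)
      𝟙-≤-* : ∀ {a b c} → (T a → T b) → (T a → T c) → 𝟙 a ≤ 𝟙 b * 𝟙 c
      𝟙-≤-* {false}                 _ _ = z≤n
      𝟙-≤-* {true} {true} {true}    _ _ = ≤-refl
      𝟙-≤-* {true} {false}          b _ = ⊥-elim (b _)
      𝟙-≤-* {true} {true} {false}   _ c = ⊥-elim (c _)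

  blockWeight-≤ : ∀ A R C →
    blockWeight A R C ≤ K * K * 𝟙 (wide A R C) + K * K * 𝟙 (tall A R C) + k' * k' * 𝟙 (contract A R C)
  blockWeight-≤ A R C with suc k' ≤? colsUsed A R C | suc k' ≤? rowsUsed A R C | 1 ≤? rowsUsed A R C
  ... | yes _ | _ | _ = begin
    blockWeight A R C       ≤⟨ blockWeight≤K*K A R C ⟩
    K * K                   ≡⟨ sym (*-identityʳ (K * K)) ⟩
    K * K * 1               ≤⟨ m≤m+n (K * K * 1) _ ⟩
    K * K * 1 + _           ≤⟨ m≤m+n _ _ ⟩
    _                       ∎
    where open ≤-Reasoning
  ... | no _ | yes _ | _ = begin
    blockWeight A R C       ≤⟨ blockWeight≤K*K A R C ⟩
    K * K                   ≡⟨ sym (*-identityʳ (K * K)) ⟩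
    K * K * 1               ≤⟨ m≤n+m (K * K * 1) (K * K * 0) ⟩
    K * K * 0 + K * K * 1   ≤⟨ m≤m+n _ _ ⟩
    _                       ∎
    where open ≤-Reasoning
  ... | no narrow | no short | yes _ = begin
    blockWeight A R C                   ≤⟨ blockWeight≤rowsUsed*colsUsed A R C ⟩
    rowsUsed A R C * colsUsed A R C     ≤⟨ *-mono-≤ (≤-pred (≰⇒> short)) (≤-pred (≰⇒> narrow)) ⟩
    k' * k'                             ≡⟨ sym (*-identityʳ (k' * k')) ⟩
    k' * k' * 1                         ≤⟨ m≤n+m _ _ ⟩
    _                                   ∎
    where open ≤-Reasoning
  ... | no _ | no _ | no empty = begin
    blockWeight A R C                   ≤⟨ blockWeight≤rowsUsed*colsUsed A R C ⟩
    rowsUsed A R C * colsUsed A R C     ≡⟨ cong (_* colsUsed A R C) (n<1⇒n≡0 (≰⇒> empty)) ⟩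
    0                                   ≤⟨ z≤n ⟩
    _                                   ∎
    where open ≤-Reasoning

  contract-witness : ∀ A R C → T (contract A R C) →
    Σ ℕ λ i → Σ ℕ λ j → i < K × j < K × T (A (R * K + i) (C * K + j))
  contract-witness A R C nonempty =
    let f , _ , f-in = ≤count⇒increasing 1 K (λ i → ⌊ rowUsed? A R C i ⌋) (toWitness nonempty)
        j , j<K , one = toWitness (proj₂ (f-in zero))
    in f zero , j , proj₁ (f-in zero) , j<K , one

  Contains-contract : ∀ {k} (τ : Perm k) A → Contains τ (contract A) → Contains τ A
  Contains-contract {k} τ A (r , c , r-inc , c-ord , ones) =
    (λ a → r a * K + i a) , (λ a → c a * K + j a) ,
    (λ a b a<b → block-< (i a) (i b) (r-inc a b a<b) (i<K a)) ,
    (λ a b τa<τb → block-< (j a) (j b) (c-ord a b τa<τb) (j<K a)) ,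
    (λ a → proj₂ (proj₂ (proj₂ (proj₂ (cell a)))))
    where
      cell : ∀ a → Σ ℕ λ i → Σ ℕ λ j → i < K × j < K × T (A (r a * K + i) (c a * K + j))
      cell a = contract-witness A (r a) (c a) (ones a)
      i j : Fin k → ℕ
      i a = proj₁ (cell a)
      j a = proj₁ (proj₂ (cell a))
      i<K : ∀ a → i a < K
      i<K a = proj₁ (proj₂ (proj₂ (cell a)))
      j<K : ∀ a → j a < K
      j<K a = proj₁ (proj₂ (proj₂ (proj₂ (cell a))))

  -- A wide block spans an increasing k-tuple of nonempty columns, and k blocks spanning the
  -- same tuple would contain τ.
  wide-count : ∀ (τ : Perm (suc k')) A → ¬ Contains τ A → ∀ m C →
    count m (λ R → wide A R C) ≤ K ^ suc k' * k'
  wide-count τ A τ⊄A m C =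
    pigeonhole-count K k m k' (λ R → wide A R C) (λ v R → ⌊ spans? v R ⌋) witness sparse
    where
      k : ℕ
      k = suc k'

      Spans : Vec ℕ k → ℕ → Set
      Spans v R = Increasing (lookup v) × (∀ a → ColUsed A R C (lookup v a))

      spans? : ∀ v R → Dec (Spans v R)
      spans? v R = increasing? (lookup v) ×-dec all? (λ a → colUsed? A R C (lookup v a))

      witness : ∀ R → R < m → T (wide A R C) →
        Σ (Vec ℕ k) λ v → (∀ a → lookup v a < K) × T ⌊ spans? v R ⌋
      witness R _ is-wide =
        let f , f-inc , f-in = ≤count⇒increasing k K (λ j → ⌊ colUsed? A R C j ⌋) (toWitness is-wide)
            lookup-f = lookup∘tabulate f
        in Vec.tabulate f ,
           (λ a → subst (_< K) (sym (lookup-f a)) (proj₁ (f-in a))) ,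
           fromWitness ((λ a b a<b → subst₂ _<_ (sym (lookup-f a)) (sym (lookup-f b)) (f-inc a b a<b)) ,
                        (λ a → subst (ColUsed A R C) (sym (lookup-f a)) (toWitness (proj₂ (f-in a)))))

      sparse : ∀ v → count m (λ R → ⌊ spans? v R ⌋) ≤ k'
      sparse v with count m (λ R → ⌊ spans? v R ⌋) ≤? k'
      ... | yes few  = few
      ... | no  many with Rs , Rs-inc , Rs-in ← ≤count⇒increasing k m (λ R → ⌊ spans? v R ⌋) (≰⇒> many) =
        ⊥-elim (τ⊄A (r , c , r-inc , c-ord , ones))
        where
          spans : ∀ a → Spans v (Rs a)
          spans a = toWitness (proj₂ (Rs-in a))
          cell : ∀ a → ColUsed A (Rs a) C (lookup v (τ ⟨$⟩ʳ a))
          cell a = proj₂ (spans a) (τ ⟨$⟩ʳ a)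
          r c : Fin k → ℕ
          r a = Rs a * K + proj₁ (cell a)
          c a = C * K + lookup v (τ ⟨$⟩ʳ a)
          r-inc : Increasing r
          r-inc a b a<b = block-< _ _ (Rs-inc a b a<b) (proj₁ (proj₂ (cell a)))
          c-ord : ∀ a b → (τ ⟨$⟩ʳ a) <ᶠ (τ ⟨$⟩ʳ b) → c a < c b
          c-ord a b τa<τb = +-monoʳ-< (C * K) (proj₁ (spans zero) _ _ τa<τb)
          ones : ∀ a → T (A (r a) (c a))
          ones a = proj₂ (proj₂ (cell a))

  -- Transposing exchanges rows and columns and turns τ into its inverse.
  tall-count : ∀ (τ : Perm (suc k')) A → ¬ Contains τ A → ∀ m R →
    count m (λ C → tall A R C) ≤ K ^ suc k' * k'
  tall-count τ A τ⊄A = wide-count (flip τ) (A ᵀ) (τ⊄A ∘ Contains-ᵀ τ A)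

weight-monoʳ-≤ : ∀ A {M N} → M ≤ N → weight A M ≤ weight A N
weight-monoʳ-≤ A {M} {N} M≤N = begin
  ∑[ r < M ] count M (A r)   ≤⟨ ∑<-mono-≤ M (λ r _ → ∑<-monoˡ-≤ (𝟙 ∘ A r) M≤N) ⟩
  ∑[ r < M ] count N (A r)   ≤⟨ ∑<-monoˡ-≤ (λ r → count N (A r)) M≤N ⟩
  ∑[ r < N ] count N (A r)   ∎
  where open ≤-Reasoning

^-between : ∀ {K} → 2 ≤ K → ∀ M → Σ ℕ λ t → suc M ≤ K ^ t × K ^ t ≤ K * suc M
^-between {K} 2≤K zero = 0 , ≤-refl , subst (1 ≤_) (sym (*-identityʳ K)) (≤-trans (s≤s z≤n) 2≤K)
^-between {K} 2≤K (suc M) with ^-between 2≤K M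
... | t , M<K^t , K^t≤K[M+1] with suc (suc M) ≤? K ^ t
...   | yes M+1<K^t = t , M+1<K^t , ≤-trans K^t≤K[M+1] (*-monoʳ-≤ K (n≤1+n (suc M)))
...   | no  K^t≤M+1 = suc t , M+1<K^t+1 , *-monoʳ-≤ K (≤-trans (≤-pred (≰⇒> K^t≤M+1)) (n≤1+n (suc M)))
  where
    K^t≡ : K ^ t ≡ suc M
    K^t≡ = ≤-antisym (≤-pred (≰⇒> K^t≤M+1)) M<K^t
    M+1<K^t+1 : suc (suc M) ≤ K ^ suc t
    M+1<K^t+1 = begin
      suc (suc M)        ≤⟨ s≤s (m≤n+m (suc M) M) ⟩
      suc M + suc M      ≡⟨ cong (suc M +_) (sym (+-identityʳ (suc M))) ⟩
      2 * suc M          ≤⟨ *-monoˡ-≤ (suc M) 2≤K ⟩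
      K * suc M          ≡⟨ cong (K *_) (sym K^t≡) ⟩
      K * K ^ t          ∎
      where open ≤-Reasoning

module MarcusTardos {k'} (τ : Perm (suc k')) where

  -- The 2 in excess of k'², the weight bound for blocks neither wide nor tall, pays for the
  -- wide and tall blocks in the recurrence.
  K : ℕ
  K = 2 + k' * k'

  open Blocks k' K

  Q c₀ : ℕ
  Q  = K ^ suc k' * k'
  c₀ = K * K * Q + 1

  weight-K^ : ∀ t A → ¬ Contains τ A → weight A (K ^ t) ≤ c₀ * K ^ t
  weight-K^ zero    A _   = begin
    weight A 1      ≡⟨ +-identityʳ _ ⟩
    count 1 (A 0)   ≤⟨ count≤ 1 (A 0) ⟩
    1               ≤⟨ m≤n+m 1 (K * K * Q) ⟩
    c₀              ≡⟨ sym (*-identityʳ c₀) ⟩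
    c₀ * 1          ∎
    where open ≤-Reasoning
  weight-K^ (suc t) A τ⊄A = begin
    weight A (K * m)
      ≡⟨ cong (weight A) (*-comm K m) ⟩
    weight A (m * K)
      ≡⟨ weight-blocks A m ⟩
    ∑[ R < m ] ∑[ C < m ] blockWeight A R C
      ≤⟨ ∑<-mono-≤ m (λ R _ → ∑<-mono-≤ m (λ C _ → blockWeight-≤ A R C)) ⟩
    ∑[ R < m ] ∑[ C < m ] (K * K * 𝟙 (wide A R C) + K * K * 𝟙 (tall A R C) + k' * k' * 𝟙 (contract A R C))
      ≡⟨ ∑<-cong m (λ R _ →
           ∑<-linear₃ m (K * K) (K * K) (k' * k') (𝟙 ∘ wide A R) (𝟙 ∘ tall A R) (𝟙 ∘ contract A R)) ⟩
    ∑[ R < m ] (K * K * count m (wide A R) + K * K * count m (tall A R) + k' * k' * count m (contract A R))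
      ≡⟨ ∑<-linear₃ m (K * K) (K * K) (k' * k')
           (λ R → count m (wide A R)) (λ R → count m (tall A R)) (λ R → count m (contract A R)) ⟩
    K * K * #wide + K * K * #tall + k' * k' * weight (contract A) m
      ≤⟨ +-mono-≤ (+-mono-≤ (*-monoʳ-≤ (K * K) #wide≤) (*-monoʳ-≤ (K * K) #tall≤))
                  (*-monoʳ-≤ (k' * k') IH) ⟩
    K * K * (m * Q) + K * K * (m * Q) + k' * k' * (c₀ * m)
      ≤⟨ m≤m+n _ (2 * m) ⟩
    K * K * (m * Q) + K * K * (m * Q) + k' * k' * (c₀ * m) + 2 * m
      ≡⟨ recurrence-closes k' Q m ⟩
    c₀ * (K * m) ∎
    where
      open ≤-Reasoning
      m #wide #tall : ℕ
      m = K ^ t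
      #wide = ∑[ R < m ] count m (wide A R)
      #tall = ∑[ R < m ] count m (tall A R)

      #wide≤ : #wide ≤ m * Q
      #wide≤ = begin
        #wide                                   ≡⟨ ∑<-comm m m (λ R C → 𝟙 (wide A R C)) ⟩
        ∑[ C < m ] count m (λ R → wide A R C)   ≤⟨ ∑<-mono-≤ m (λ C _ → wide-count τ A τ⊄A m C) ⟩
        ∑[ _ < m ] Q                            ≡⟨ ∑<-const m Q ⟩
        m * Q                                   ∎

      #tall≤ : #tall ≤ m * Q
      #tall≤ = ≤-trans (∑<-mono-≤ m (λ R _ → tall-count τ A τ⊄A m R)) (≤-reflexive (∑<-const m Q))

      IH : weight (contract A) m ≤ c₀ * m
      IH = weight-K^ t (contract A) (τ⊄A ∘ Contains-contract τ A)

      recurrence-closes : ∀ k' Q m → let K = 2 + k' * k' in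
        K * K * (m * Q) + K * K * (m * Q) + k' * k' * ((K * K * Q + 1) * m) + 2 * m ≡ (K * K * Q + 1) * (K * m)
      recurrence-closes = solve-∀

marcus-tardos : ∀ {k'} (τ : Perm (suc k')) → Σ ℕ λ c → ∀ M A → ¬ Contains τ A → weight A M ≤ c * M
marcus-tardos τ = c₀ * K , bound
  where
    open MarcusTardos τ
    bound : ∀ M A → ¬ Contains τ A → weight A M ≤ c₀ * K * M
    bound zero    A _   = z≤n
    bound (suc M) A τ⊄A =
      let t , M<K^t , K^t≤ = ^-between (s≤s (s≤s z≤n)) M in begin
      weight A (suc M)    ≤⟨ weight-monoʳ-≤ A M<K^t ⟩
      weight A (K ^ t)    ≤⟨ weight-K^ t A τ⊄A ⟩
      c₀ * K ^ t          ≤⟨ *-monoʳ-≤ c₀ K^t≤ ⟩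
      c₀ * (K * suc M)    ≡⟨ sym (*-assoc c₀ K (suc M)) ⟩
      c₀ * K * suc M      ∎
      where open ≤-Reasoning

-- Patterns of sparsely gridded permutations

[q*d+r]/d≡q : ∀ q {r d} .{{_ : NonZero d}} → r < d → (q * d + r) / d ≡ q
[q*d+r]/d≡q q {r} {d} r<d = begin
  (q * d + r) / d     ≡⟨ +-distrib-/-∣ˡ r (divides-refl q) ⟩
  q * d / d + r / d   ≡⟨ cong₂ _+_ (m*n/n≡m q d) (m<n⇒m/n≡0 r<d) ⟩
  q + 0               ≡⟨ +-identityʳ q ⟩
  q                   ∎
  where open ≡-Reasoning

[q*d+r]%d≡r : ∀ q {r d} .{{_ : NonZero d}} → r < d → (q * d + r) % d ≡ r
[q*d+r]%d≡r q {r} {d} r<d = begin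
  (q * d + r) % d     ≡⟨ cong (_% d) (+-comm (q * d) r) ⟩
  (r + q * d) % d     ≡⟨ [m+kn]%n≡m%n r q d ⟩
  r % d               ≡⟨ m<n⇒m%n≡m r<d ⟩
  r                   ∎
  where open ≡-Reasoning

weight≡count : ∀ A M .{{_ : NonZero M}} → weight A M ≡ count (M * M) (λ x → A (x / M) (x % M))
weight≡count A M = sym (begin
  count (M * M) (λ x → A (x / M) (x % M))
    ≡⟨ ∑<-blocks M M (λ x → 𝟙 (A (x / M) (x % M))) ⟩
  ∑[ q < M ] count M (λ r → A ((q * M + r) / M) ((q * M + r) % M))
    ≡⟨ ∑<-cong M (λ q _ → ∑<-cong M λ r r<M →
         cong₂ (λ i j → 𝟙 (A i j)) ([q*d+r]/d≡q q r<M) ([q*d+r]%d≡r q r<M)) ⟩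
  weight A M ∎)
  where open ≡-Reasoning

preserves-<⇒reflects-< : ∀ {a} {A : Set a} {m n} (f : A → Fin m) (g : A → Fin n) →
  (∀ x y → f x ≡ f y → g x ≡ g y) → (∀ x y → f x <ᶠ f y → g x <ᶠ g y) →
  ∀ x y → g x <ᶠ g y → f x <ᶠ f y
preserves-<⇒reflects-< f g f≡⇒g≡ f<⇒g< x y gx<gy with <ᶠ-cmp (f x) (f y)
... | tri< fx<fy _ _ = fx<fy
... | tri≈ _ fx≡fy _ = ⊥-elim (<ᶠ-irrefl (f≡⇒g≡ x y fx≡fy) gx<gy)
... | tri> _ _ fy<fx = ⊥-elim (<ᶠ-asym gx<gy (f<⇒g< y x fy<fx))

increasing⇒injective : ∀ {m n} (f : Fin m → Fin n) → (∀ x y → x <ᶠ y → f x <ᶠ f y) →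
  ∀ x y → f x ≡ f y → x ≡ y
increasing⇒injective f f-inc x y fx≡fy with <ᶠ-cmp x y
... | tri< x<y _ _ = ⊥-elim (<ᶠ-irrefl fx≡fy (f-inc x y x<y))
... | tri≈ _ x≡y _ = x≡y
... | tri> _ _ y<x = ⊥-elim (<ᶠ-irrefl (sym fx≡fy) (f-inc y x y<x))

⟨$⟩ʳ-injective : ∀ {n} (π : Perm n) {x y} → π ⟨$⟩ʳ x ≡ π ⟨$⟩ʳ y → x ≡ y
⟨$⟩ʳ-injective π πx≡πy = trans (sym (inverseˡ π)) (trans (cong (π ⟨$⟩ˡ_) πx≡πy) (inverseˡ π))

record SparseGridding {n} (σ : Perm n) (M : ℕ) : Set where
  field
    positionBlock valueBlock : Fin n → ℕ
    positionBlock<M : ∀ x → positionBlock x < M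
    valueBlock<M    : ∀ x → valueBlock x < M
    positionBlock-reflects-< : ∀ x y → positionBlock x < positionBlock y → x <ᶠ y
    valueBlock-reflects-<    : ∀ x y → valueBlock x < valueBlock y → (σ ⟨$⟩ʳ x) <ᶠ (σ ⟨$⟩ʳ y)
    cell-injective : ∀ x y → positionBlock x ≡ positionBlock y → valueBlock x ≡ valueBlock y → x ≡ y

module _ {n M} {σ : Perm n} (G : SparseGridding σ M) {ℓ} (π : Perm ℓ) (π≼σ : IsPattern π σ) where
  open SparseGridding G

  private
    e : Fin ℓ → Fin n
    e = proj₁ π≼σ
    e-inc : ∀ l l' → l <ᶠ l' → e l <ᶠ e l'
    e-inc = proj₁ (proj₂ π≼σ)
    e-ord : ∀ l l' → (π ⟨$⟩ʳ l) <ᶠ (π ⟨$⟩ʳ l') → (σ ⟨$⟩ʳ e l) <ᶠ (σ ⟨$⟩ʳ e l')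
    e-ord = proj₂ (proj₂ π≼σ)

  OccupiedBy : ℕ → ℕ → Fin ℓ → Set
  OccupiedBy r c l = positionBlock (e l) ≡ r × valueBlock (e l) ≡ c

  occurrenceMatrix : Matrix
  occurrenceMatrix r c = ⌊ any? (λ l → (positionBlock (e l) ≟ r) ×-dec (valueBlock (e l) ≟ c)) ⌋

  length≤weight-occurrenceMatrix : .{{_ : NonZero M}} → ℓ ≤ weight occurrenceMatrix M
  length≤weight-occurrenceMatrix = subst (ℓ ≤_) (sym (weight≡count occurrenceMatrix M))
    (injective⇒≤count (M * M) (λ x → occurrenceMatrix (x / M) (x % M)) cellIndex cellIndex-injective λ l →
      cellIndex<M*M l ,
      subst₂ (λ i j → T (occurrenceMatrix i j)) (sym (/-cellIndex l)) (sym (%-cellIndex l))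
             (fromWitness (l , refl , refl)))
    where
      cellIndex : Fin ℓ → ℕ
      cellIndex l = positionBlock (e l) * M + valueBlock (e l)
      /-cellIndex : ∀ l → cellIndex l / M ≡ positionBlock (e l)
      /-cellIndex l = [q*d+r]/d≡q (positionBlock (e l)) (valueBlock<M (e l))
      %-cellIndex : ∀ l → cellIndex l % M ≡ valueBlock (e l)
      %-cellIndex l = [q*d+r]%d≡r (positionBlock (e l)) (valueBlock<M (e l))
      cellIndex<M*M : ∀ l → cellIndex l < M * M
      cellIndex<M*M l = subst (cellIndex l <_) (+-identityʳ (M * M))
        (block-< (valueBlock (e l)) 0 (positionBlock<M (e l)) (valueBlock<M (e l)))
      cellIndex-injective : ∀ l l' → cellIndex l ≡ cellIndex l' → l ≡ l'
      cellIndex-injective l l' eq = increasing⇒injective e e-inc l l' (cell-injective (e l) (e l')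
        (trans (sym (/-cellIndex l)) (trans (cong (_/ M) eq) (/-cellIndex l')))
        (trans (sym (%-cellIndex l)) (trans (cong (_% M) eq) (%-cellIndex l'))))

  Contains⇒IsPattern : ∀ {k} {τ : Perm k} → Contains τ occurrenceMatrix → IsPattern τ π
  Contains⇒IsPattern {k} {τ} (r , c , r-inc , c-ord , ones) = g , g-inc , g-ord
    where
      occupant : ∀ a → Σ (Fin ℓ) (OccupiedBy (r a) (c a))
      occupant a = toWitness (ones a)
      g : Fin k → Fin ℓ
      g a = proj₁ (occupant a)
      positionBlock-g : ∀ a → positionBlock (e (g a)) ≡ r a
      positionBlock-g a = proj₁ (proj₂ (occupant a))
      valueBlock-g : ∀ a → valueBlock (e (g a)) ≡ c a
      valueBlock-g a = proj₂ (proj₂ (occupant a))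

      g-inc : ∀ a b → a <ᶠ b → g a <ᶠ g b
      g-inc a b a<b = preserves-<⇒reflects-< id e (λ _ _ → cong e) e-inc (g a) (g b)
        (positionBlock-reflects-< _ _ (subst₂ _<_ (sym (positionBlock-g a)) (sym (positionBlock-g b)) (r-inc a b a<b)))

      g-ord : ∀ a b → (τ ⟨$⟩ʳ a) <ᶠ (τ ⟨$⟩ʳ b) → (π ⟨$⟩ʳ g a) <ᶠ (π ⟨$⟩ʳ g b)
      g-ord a b τa<τb = preserves-<⇒reflects-< (π ⟨$⟩ʳ_) ((σ ⟨$⟩ʳ_) ∘ e)
        (λ _ _ πx≡πy → cong ((σ ⟨$⟩ʳ_) ∘ e) (⟨$⟩ʳ-injective π πx≡πy)) e-ord (g a) (g b)
        (valueBlock-reflects-< _ _ (subst₂ _<_ (sym (valueBlock-g a)) (sym (valueBlock-g b)) (c-ord a b τa<τb)))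

avoider-length≤gridSize : ∀ {k'} (τ : Perm (suc k')) → Σ ℕ λ c →
  ∀ {n M} .{{_ : NonZero M}} {σ : Perm n} → SparseGridding σ M →
  ∀ {ℓ} (π : Perm ℓ) → IsPattern π σ → ¬ IsPattern τ π → ℓ ≤ c * M
avoider-length≤gridSize τ with c , weight≤ ← marcus-tardos τ = c , bound
  where
    bound : ∀ {n M} .{{_ : NonZero M}} {σ : Perm n} → SparseGridding σ M →
      ∀ {ℓ} (π : Perm ℓ) → IsPattern π σ → ¬ IsPattern τ π → ℓ ≤ c * M
    bound {M = M} G {ℓ} π π≼σ τ⋠π = begin
      ℓ            ≤⟨ length≤weight-occurrenceMatrix G π π≼σ ⟩
      weight A M   ≤⟨ weight≤ M A (τ⋠π ∘ Contains⇒IsPattern G π π≼σ {τ = τ}) ⟩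
      c * M        ∎
      where
        open ≤-Reasoning
        A : Matrix
        A = occurrenceMatrix G π π≼σ

-- The square grid permutation

module SquareGrid (m' n : ℕ) (m*m≤n : suc m' * suc m' ≤ n) where

  m : ℕ
  m = suc m'

  transpose : ℕ → ℕ
  transpose p = (p % m) * m + p / m

  p/m<m : ∀ {p} → p < m * m → p / m < m
  p/m<m = m<n*o⇒m/o<n

  transpose<m*m : ∀ {p} → p < m * m → transpose p < m * m
  transpose<m*m {p} p<mm = begin-strict
    (p % m) * m + p / m   <⟨ block-< (p / m) 0 (m%n<n p m) (p/m<m p<mm) ⟩
    m * m + 0             ≡⟨ +-identityʳ (m * m) ⟩
    m * m                 ∎
    where open ≤-Reasoning

  transpose-/ : ∀ {p} → p < m * m → transpose p / m ≡ p % m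
  transpose-/ {p} p<mm = [q*d+r]/d≡q (p % m) (p/m<m p<mm)

  transpose-% : ∀ {p} → p < m * m → transpose p % m ≡ p / m
  transpose-% {p} p<mm = [q*d+r]%d≡r (p % m) (p/m<m p<mm)

  transpose-involutive : ∀ {p} → p < m * m → transpose (transpose p) ≡ p
  transpose-involutive {p} p<mm = begin
    (transpose p % m) * m + transpose p / m
      ≡⟨ cong₂ (λ q r → q * m + r) (transpose-% p<mm) (transpose-/ p<mm) ⟩
    (p / m) * m + p % m                       ≡⟨ +-comm _ (p % m) ⟩
    p % m + (p / m) * m                       ≡⟨ sym (m≡m%n+[m/n]*n p m) ⟩
    p                                         ∎
    where open ≡-Reasoning

  onGrid : (ℕ → ℕ) → (ℕ → ℕ) → ℕ → ℕ
  onGrid f g p with p <? m * m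
  ... | yes _ = f p
  ... | no  _ = g p

  onGrid-grid : ∀ f g {p} → p < m * m → onGrid f g p ≡ f p
  onGrid-grid f g {p} p<mm with p <? m * m
  ... | yes _   = refl
  ... | no  p≮ = ⊥-elim (p≮ p<mm)

  onGrid-tail : ∀ f g {p} → m * m ≤ p → onGrid f g p ≡ g p
  onGrid-tail f g {p} mm≤p with p <? m * m
  ... | yes p<mm = ⊥-elim (≤⇒≯ mm≤p p<mm)
  ... | no  _    = refl

  swap : ℕ → ℕ
  swap = onGrid transpose id

  block : ℕ → ℕ
  block = onGrid (_/ m) (λ p → m + (p ∸ m * m))

  M : ℕ
  M = m + (n ∸ m * m)

  swap-involutive : ∀ p → swap (swap p) ≡ p
  swap-involutive p with <-≤-connex p (m * m)
  ... | inj₁ p<mm = begin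
    swap (swap p)               ≡⟨ cong swap (onGrid-grid transpose id p<mm) ⟩
    swap (transpose p)          ≡⟨ onGrid-grid transpose id (transpose<m*m p<mm) ⟩
    transpose (transpose p)     ≡⟨ transpose-involutive p<mm ⟩
    p                           ∎
    where open ≡-Reasoning
  ... | inj₂ mm≤p = trans (cong swap (onGrid-tail transpose id mm≤p)) (onGrid-tail transpose id mm≤p)

  swap-< : ∀ {p} → p < n → swap p < n
  swap-< {p} p<n with <-≤-connex p (m * m)
  ... | inj₁ p<mm = subst (_< n) (sym (onGrid-grid transpose id p<mm)) (<-≤-trans (transpose<m*m p<mm) m*m≤n)
  ... | inj₂ mm≤p = subst (_< n) (sym (onGrid-tail transpose id mm≤p)) p<n

  block-grid : ∀ {p} → p < m * m → block p ≡ p / m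
  block-grid = onGrid-grid (_/ m) _

  block-tail : ∀ {p} → m * m ≤ p → block p ≡ m + (p ∸ m * m)
  block-tail = onGrid-tail (_/ m) _

  block-swap-grid : ∀ {p} → p < m * m → block (swap p) ≡ p % m
  block-swap-grid {p} p<mm = begin
    block (swap p)        ≡⟨ cong block (onGrid-grid transpose id p<mm) ⟩
    block (transpose p)   ≡⟨ block-grid (transpose<m*m p<mm) ⟩
    transpose p / m       ≡⟨ transpose-/ p<mm ⟩
    p % m                 ∎
    where open ≡-Reasoning

  grid-block<m : ∀ {p} → p < m * m → block p < m
  grid-block<m p<mm = subst (_< m) (sym (block-grid p<mm)) (p/m<m p<mm)

  grid-block<tail-block : ∀ {x y} → x < m * m → m * m ≤ y → block x < block y
  grid-block<tail-block {x} {y} x<mm mm≤y = begin-strict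
    block x               <⟨ grid-block<m x<mm ⟩
    m                     ≤⟨ m≤m+n m _ ⟩
    m + (y ∸ m * m)       ≡⟨ sym (block-tail mm≤y) ⟩
    block y               ∎
    where open ≤-Reasoning

  block-mono-≤ : ∀ {x y} → x ≤ y → block x ≤ block y
  block-mono-≤ {x} {y} x≤y with <-≤-connex x (m * m) | <-≤-connex y (m * m)
  ... | inj₁ x<mm | inj₁ y<mm = subst₂ _≤_ (sym (block-grid x<mm)) (sym (block-grid y<mm)) (/-monoˡ-≤ m x≤y)
  ... | inj₁ x<mm | inj₂ mm≤y = <⇒≤ (grid-block<tail-block x<mm mm≤y)
  ... | inj₂ mm≤x | inj₁ y<mm = ⊥-elim (≤⇒≯ mm≤x (≤-<-trans x≤y y<mm))
  ... | inj₂ mm≤x | inj₂ mm≤y = subst₂ _≤_ (sym (block-tail mm≤x)) (sym (block-tail mm≤y))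
                                  (+-monoʳ-≤ m (∸-monoˡ-≤ (m * m) x≤y))

  block-reflects-< : ∀ {x y} → block x < block y → x < y
  block-reflects-< {x} {y} bx<by with x <? y
  ... | yes x<y = x<y
  ... | no  x≮y = ⊥-elim (<⇒≱ bx<by (block-mono-≤ (≮⇒≥ x≮y)))

  block<M : ∀ {p} → p < n → block p < M
  block<M {p} p<n with <-≤-connex p (m * m)
  ... | inj₁ p<mm = ≤-trans (grid-block<m p<mm) (m≤m+n m _)
  ... | inj₂ mm≤p = subst (_< M) (sym (block-tail mm≤p)) (+-monoʳ-< m (∸-monoˡ-< p<n mm≤p))

  block-injective : ∀ {x y} → block x ≡ block y → block (swap x) ≡ block (swap y) → x ≡ y
  block-injective {x} {y} bx≡by bsx≡bsy with <-≤-connex x (m * m) | <-≤-connex y (m * m)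
  ... | inj₁ x<mm | inj₁ y<mm = begin
    x                     ≡⟨ m≡m%n+[m/n]*n x m ⟩
    x % m + (x / m) * m   ≡⟨ cong₂ (λ r q → r + q * m) %-equal /-equal ⟩
    y % m + (y / m) * m   ≡⟨ sym (m≡m%n+[m/n]*n y m) ⟩
    y                     ∎
    where
      open ≡-Reasoning
      /-equal : x / m ≡ y / m
      /-equal = trans (sym (block-grid x<mm)) (trans bx≡by (block-grid y<mm))
      %-equal : x % m ≡ y % m
      %-equal = trans (sym (block-swap-grid x<mm)) (trans bsx≡bsy (block-swap-grid y<mm))
  ... | inj₁ x<mm | inj₂ mm≤y = ⊥-elim (<-irrefl bx≡by (grid-block<tail-block x<mm mm≤y))
  ... | inj₂ mm≤x | inj₁ y<mm = ⊥-elim (<-irrefl (sym bx≡by) (grid-block<tail-block y<mm mm≤x))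
  ... | inj₂ mm≤x | inj₂ mm≤y = begin
    x                     ≡⟨ sym (m∸n+n≡m mm≤x) ⟩
    (x ∸ m * m) + m * m   ≡⟨ cong (_+ m * m) (+-cancelˡ-≡ m _ _ tails-equal) ⟩
    (y ∸ m * m) + m * m   ≡⟨ m∸n+n≡m mm≤y ⟩
    y                     ∎
    where
      open ≡-Reasoning
      tails-equal : m + (x ∸ m * m) ≡ m + (y ∸ m * m)
      tails-equal = trans (sym (block-tail mm≤x)) (trans bx≡by (block-tail mm≤y))

  M≤3m : n < suc m * suc m → M ≤ 3 * m
  M≤3m n<[m+1]² = +-monoʳ-≤ m (begin
    n ∸ m * m                   ≤⟨ ∸-monoˡ-≤ (m * m) (≤-pred (subst (n <_) (square-suc m) n<[m+1]²)) ⟩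
    (m * m + 2 * m) ∸ m * m     ≡⟨ m+n∸m≡n (m * m) (2 * m) ⟩
    2 * m                       ∎)
    where
      open ≤-Reasoning
      square-suc : ∀ m → suc m * suc m ≡ suc (m * m + 2 * m)
      square-suc = solve-∀

  swapᶠ : Fin n → Fin n
  swapᶠ x = fromℕ< (swap-< (toℕ<n x))

  toℕ-swapᶠ : ∀ x → toℕ (swapᶠ x) ≡ swap (toℕ x)
  toℕ-swapᶠ x = toℕ-fromℕ< _

  swapᶠ-involutive : ∀ x → swapᶠ (swapᶠ x) ≡ x
  swapᶠ-involutive x = toℕ-injective (begin
    toℕ (swapᶠ (swapᶠ x))     ≡⟨ toℕ-swapᶠ (swapᶠ x) ⟩
    swap (toℕ (swapᶠ x))      ≡⟨ cong swap (toℕ-swapᶠ x) ⟩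
    swap (swap (toℕ x))       ≡⟨ swap-involutive (toℕ x) ⟩
    toℕ x                     ∎)
    where open ≡-Reasoning

  gridPerm : Perm n
  gridPerm = permutation swapᶠ swapᶠ swapᶠ-involutive swapᶠ-involutive

  gridding : SparseGridding gridPerm M
  gridding = record
    { positionBlock            = block ∘ toℕ
    ; valueBlock               = block ∘ toℕ ∘ swapᶠ
    ; positionBlock<M          = block<M ∘ toℕ<n
    ; valueBlock<M             = block<M ∘ toℕ<n ∘ swapᶠ
    ; positionBlock-reflects-< = λ _ _ → block-reflects-<
    ; valueBlock-reflects-<    = λ _ _ → block-reflects-<
    ; cell-injective           = λ x y bx≡by bsx≡bsy → toℕ-injective (block-injective bx≡by
        (trans (cong block (sym (toℕ-swapᶠ x))) (trans bsx≡bsy (cong block (toℕ-swapᶠ y)))))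
    }

integer-sqrt : ∀ n → Σ ℕ λ m → m * m ≤ n × n < suc m * suc m
integer-sqrt zero = 0 , z≤n , s≤s z≤n
integer-sqrt (suc n) with integer-sqrt n
... | m , m²≤n , n<[m+1]² with suc m * suc m ≤? suc n
...   | yes [m+1]²≤n+1 = suc m , [m+1]²≤n+1 , <-≤-trans (s≤s n<[m+1]²) (square-gap m)
  where
    square-gap : ∀ m → suc (suc m * suc m) ≤ suc (suc m) * suc (suc m)
    square-gap m = subst (suc (suc m * suc m) ≤_) (expand m) (m≤m+n _ _)
      where
        expand : ∀ m → suc (suc m * suc m) + (suc m + suc m) ≡ suc (suc m) * suc (suc m)
        expand = solve-∀
...   | no  [m+1]²≰n+1 = m , m≤n⇒m≤1+n m²≤n , ≰⇒> [m+1]²≰n+1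

positive-sqrt : ∀ n' → Σ ℕ λ m' → suc m' * suc m' ≤ suc n' × suc n' < suc (suc m') * suc (suc m')
positive-sqrt n' with integer-sqrt (suc n')
... | zero   , _ , s≤s ()
... | suc m' , bounds = m' , bounds

sqrtGridPerm : (n : ℕ) → Perm n
sqrtGridPerm zero     = Permutation.id
sqrtGridPerm (suc n') = SquareGrid.gridPerm (proj₁ (positive-sqrt n')) (suc n') (proj₁ (proj₂ (positive-sqrt n')))

sqrtGridPerm-avoider-length²≤ : ∀ {k'} (τ : Perm (suc k')) → Σ ℕ λ G →
  ∀ {n ℓ} (π : Perm ℓ) → IsPattern π (sqrtGridPerm n) → ¬ IsPattern τ π → ℓ * ℓ ≤ G * n
sqrtGridPerm-avoider-length²≤ τ with c , ℓ≤cM ← avoider-length≤gridSize τ = 9 * c * c , bound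
  where
    bound : ∀ {n ℓ} (π : Perm ℓ) → IsPattern π (sqrtGridPerm n) → ¬ IsPattern τ π →
      ℓ * ℓ ≤ 9 * c * c * n
    bound {zero}   {zero}  π _       _   = z≤n
    bound {zero}   {suc _} π (e , _) _   with () ← e zero
    bound {suc n'} {ℓ}     π π≼σ     τ⋠π = begin
      ℓ * ℓ                           ≤⟨ *-mono-≤ ℓ≤3cm ℓ≤3cm ⟩
      (c * (3 * m)) * (c * (3 * m))   ≡⟨ regroup c m ⟩
      9 * c * c * (m * m)             ≤⟨ *-monoʳ-≤ (9 * c * c) m²≤n ⟩
      9 * c * c * suc n'              ∎
      where
        open ≤-Reasoning
        m' m : ℕ
        m' = proj₁ (positive-sqrt n')
        m  = suc m'
        m²≤n : m * m ≤ suc n'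
        m²≤n = proj₁ (proj₂ (positive-sqrt n'))
        open SquareGrid m' (suc n') m²≤n using (gridding; M; M≤3m)
        ℓ≤3cm : ℓ ≤ c * (3 * m)
        ℓ≤3cm = ≤-trans (ℓ≤cM gridding π π≼σ τ⋠π)
                        (*-monoʳ-≤ c (M≤3m (proj₂ (proj₂ (positive-sqrt n')))))
        regroup : ∀ c m → (c * (3 * m)) * (c * (3 * m)) ≡ 9 * c * c * (m * m)
        regroup = solve-∀

-- Asymptotics

^-distrib-* : ∀ x y e → (x * y) ^ e ≡ x ^ e * y ^ e
^-distrib-* x y zero    = refl
^-distrib-* x y (suc e) = trans (cong (x * y *_) (^-distrib-* x y e)) (interchange x y (x ^ e) (y ^ e))
  where
    interchange : ∀ x y u v → x * y * (u * v) ≡ x * u * (y * v)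
    interchange = solve-∀

^-double : ∀ x e → x ^ (2 * e) ≡ (x * x) ^ e
^-double x e = trans (sym (^-*-assoc x 2 e)) (cong (_^ e) (cong (x *_) (*-identityʳ x)))

O-sqrt⇒LittleOPow : ∀ (Adm : ℕ → ℕ → Set) G → (∀ {n ℓ} → Adm n ℓ → ℓ * ℓ ≤ G * n) →
  ∀ p q → LittleOPow Adm (suc p) q
O-sqrt⇒LittleOPow Adm G ℓ²≤Gn p q a b = suc (D ^ q) , bound
  where
    D : ℕ
    D = suc b * suc b * G
    bound : ∀ n → n ≥ suc (D ^ q) → ∀ ℓ → Adm n ℓ →
      (suc b * ℓ) ^ (2 * q) ≤ suc a ^ (2 * q) * n ^ (q + 2 * suc p)
    bound (suc n') n>D^q ℓ adm = begin
      (suc b * ℓ) ^ (2 * q)                   ≡⟨ ^-double (suc b * ℓ) q ⟩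
      (suc b * ℓ * (suc b * ℓ)) ^ q           ≡⟨ cong (_^ q) (interchange (suc b) ℓ) ⟩
      (suc b * suc b * (ℓ * ℓ)) ^ q           ≤⟨ ^-monoˡ-≤ q (*-monoʳ-≤ (suc b * suc b) (ℓ²≤Gn adm)) ⟩
      (suc b * suc b * (G * n)) ^ q           ≡⟨ cong (_^ q) (sym (*-assoc (suc b * suc b) G n)) ⟩
      (D * n) ^ q                             ≡⟨ ^-distrib-* D n q ⟩
      D ^ q * n ^ q                           ≤⟨ *-monoˡ-≤ (n ^ q) (<⇒≤ n>D^q) ⟩
      n ^ suc q                               ≤⟨ ^-monoʳ-≤ n (subst (_≤ q + 2 * suc p) (+-comm q 1) q+1≤) ⟩
      n ^ (q + 2 * suc p)                     ≤⟨ m≤n*m _ (suc a ^ (2 * q)) {{m^n≢0 (suc a) (2 * q)}} ⟩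
      suc a ^ (2 * q) * n ^ (q + 2 * suc p)   ∎
      where
        open ≤-Reasoning
        n : ℕ
        n = suc n'
        q+1≤ : q + 1 ≤ q + 2 * suc p
        q+1≤ = +-monoʳ-≤ q (s≤s z≤n)
        interchange : ∀ x y → x * y * (x * y) ≡ x * x * (y * y)
        interchange = solve-∀

empty-IsPattern : ∀ {n} (τ : Perm 0) (σ : Perm n) → IsPattern τ σ
empty-IsPattern τ σ = (λ ()) , (λ ()) , (λ ())

corollary1 : (C : PatternClass) → (p q : ℕ) →
    Σ ((n : ℕ) → Perm n) λ σ →
      LittleOPow
        (λ n ℓ → Σ (Perm ℓ) λ π →
           IsCommonCPattern C π ((n , σ n) ∷ (n , σ n) ∷ []))
        (suc p) (suc q)
corollary1 ((zero , τ) ∷⁺ _) p q = sqrtGridPerm , O-sqrt⇒LittleOPow _ 0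
  (λ { (π , (τ⋠π ∷ᴬ _) , _) → ⊥-elim (τ⋠π (empty-IsPattern τ π)) }) p (suc q)
corollary1 ((suc k' , τ) ∷⁺ _) p q with G , ℓ²≤Gn ← sqrtGridPerm-avoider-length²≤ τ =
  sqrtGridPerm , O-sqrt⇒LittleOPow _ G
    (λ { (π , (τ⋠π ∷ᴬ _) , (π≼σ ∷ᴬ _)) → ℓ²≤Gn π π≼σ τ⋠π }) p (suc q)
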